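{- Let $p$ be a prime and let $(\mathcal G,\mathbf x)$ and $(\mathcal H,\mathbf y)$ be finite similar relational structures with $r$ distinguished vertices $\mathbf x=(x_1,\dots,x_r)$, $\mathbf y=(y_1,\dots,y_r)$, both $p$-rigid. Then $(\mathcal G,\mathbf x)\cong(\mathcal H,\mathbf y)$ if and only if $\mathsf{hom}((\mathcal K,\mathbf z),(\mathcal G,\mathbf x))\equiv \mathsf{hom}((\mathcal K,\mathbf z),(\mathcal H,\mathbf y))\pmod p$ for all finite relational structures $(\mathcal K,\mathbf z)$ (similar to $\mathcal G$) with $r$ distinguished vertices.
   Context: A relational structure with distinguished vertices $(\mathcal H,\mathbf a)$ is a structure $\mathcal H$ together with a tuple $\mathbf a=(a_1,\dots,a_r)$ of elements of its base set (not necessarily distinct). A homomorphism $(\mathcal G,\mathbf a)\to(\mathcal H,\mathbf b)$ is a homomorphism $\mathcal G\to\mathcal H$ mapping $a_i$ to $b_i$ for all $i$; $\mathsf{hom}$ counts them. An isomorphism $(\mathcal G,\mathbf x)\cong(\mathcal H,\mathbf y)$ is a structure isomorphism mapping $x_i$ to $y_i$ for each $i$. $(\mathcal H,\mathbf y)$ is $p$-rigid if it has no automorphism of order $p$, where automorphisms are required to fix each distinguished vertex. -}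

module Defs where

open import Data.Nat using (ℕ; zero; suc; ∣_-_∣; _<_)
open import Data.Nat.Divisibility using (_∣_)
open import Data.Fin using (Fin; _≟_)
import Data.Fin as Fin
open import Data.Fin.Properties using (all?)
open import Data.Vec using (Vec)
import Data.Vec as Vec
open import Data.Vec.Properties using (≡-dec)
open import Data.List using (List; []; _∷_; map; concatMap; length; filter; allFin)
open import Data.List.Relation.Unary.All as All using (All)
open import Data.List.Membership.Propositional using (_∈_)
import Data.List.Membership.DecPropositional as DecMem
open import Data.List.Relation.Unary.Any using (here; there)
open import Data.Product using (Σ; ∃; _×_; _,_)
open import Function using (_∘_; id)
open import Function.Definitions using (Bijective)
open import Relation.Binary.PropositionalEquality using (_≡_; _≢_; refl)
open import Relation.Nullary using (Dec; yes; no; ¬_)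
open import Relation.Nullary.Decidable using (_×-dec_; map′)

record Sig : Set where
  field
    nrel  : ℕ
    arity : Fin nrel → ℕ
open Sig public

-- Base set is Fin size; each relation is given as a finite list of tuples
-- (a tuple t belongs to the relation iff t ∈ rel i).
record Str (σ : Sig) (r : ℕ) : Set where
  field
    size : ℕ
    rel  : (i : Fin (nrel σ)) → List (Vec (Fin size) (arity σ i))
    dist : Fin r → Fin size
open Str public

module _ {σ : Sig} {r : ℕ} where

  IsHom : (G H : Str σ r) → (Fin (size G) → Fin (size H)) → Set
  IsHom G H f =
    (∀ (i : Fin (nrel σ)) (t : Vec (Fin (size G)) (arity σ i)) →
       t ∈ rel G i → Vec.map f t ∈ rel H i)
    × (∀ (j : Fin r) → f (dist G j) ≡ dist H j)

  IsIso : (G H : Str σ r) → (Fin (size G) → Fin (size H)) → Set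
  IsIso G H f =
    Bijective _≡_ _≡_ f
    × (∀ (i : Fin (nrel σ)) (t : Vec (Fin (size G)) (arity σ i)) →
         (t ∈ rel G i → Vec.map f t ∈ rel H i) × (Vec.map f t ∈ rel H i → t ∈ rel G i))
    × (∀ (j : Fin r) → f (dist G j) ≡ dist H j)

  _≅_ : Str σ r → Str σ r → Set
  G ≅ H = ∃ λ f → IsIso G H f

  iter : {A : Set} → ℕ → (A → A) → A → A
  iter zero    g = id
  iter (suc n) g = g ∘ iter n g

  AutOfOrder : ℕ → (G : Str σ r) → (Fin (size G) → Fin (size G)) → Set
  AutOfOrder p G g =
    IsIso G G g
    × (∀ v → iter p g v ≡ v)
    × (∀ k → 0 < k → k < p → ¬ (∀ v → iter k g v ≡ v))

  PRigid : ℕ → Str σ r → Set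
  PRigid p G = ∀ g → ¬ AutOfOrder p G g

  private
    ∀∈⇒All : {A : Set} {P : A → Set} (xs : List A) → (∀ x → x ∈ xs → P x) → All P xs
    ∀∈⇒All []       h = All.[]
    ∀∈⇒All (x ∷ xs) h = h x (here refl) All.∷ ∀∈⇒All xs (λ y m → h y (there m))

    All⇒∀∈ : {A : Set} {P : A → Set} {xs : List A} → All P xs → (∀ x → x ∈ xs → P x)
    All⇒∀∈ (px All.∷ _)  x (here refl) = px
    All⇒∀∈ (_ All.∷ ps) x (there m)   = All⇒∀∈ ps x m

  isHom? : (G H : Str σ r) (f : Fin (size G) → Fin (size H)) → Dec (IsHom G H f)
  isHom? G H f = all? relOK ×-dec all? (λ j → f (dist G j) ≟ dist H j)
    where
      relOK : ∀ i → Dec (∀ t → t ∈ rel G i → Vec.map f t ∈ rel H i)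
      relOK i = map′ (λ a t m → All⇒∀∈ a t m) (λ h → ∀∈⇒All (rel G i) h)
                     (All.all? (λ t → DecMem._∈?_ (≡-dec _≟_) (Vec.map f t) (rel H i)) (rel G i))

allFuns : (n m : ℕ) → List (Fin n → Fin m)
allFuns zero    m = (λ ()) ∷ []
allFuns (suc n) m = concatMap (λ a → map (λ g → cons a g) (allFuns n m)) (allFin m)
  where
    cons : {k : ℕ} → Fin m → (Fin k → Fin m) → Fin (suc k) → Fin m
    cons a g Fin.zero    = a
    cons a g (Fin.suc i) = g i

hom : {σ : Sig} {r : ℕ} → Str σ r → Str σ r → ℕ
hom K G = length (filter (isHom? K G) (allFuns (size K) (size G)))

_≡_[mod_] : ℕ → ℕ → ℕ → Set
a ≡ b [mod p ] = p ∣ ∣ a - b ∣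

module Submission where

-- For the converse, count homomorphisms
-- K → G that separate a list D of vertex pairs of K: those separating a further pair (u, v) are
-- all of them minus those identifying u and v, and the latter are the homomorphisms out of the
-- smaller contraction K/(u = v). Induction on the size of K and on D therefore turns the
-- hypothesis into inj(K, G) ≡ inj(K, H) (mod p) for the numbers of injective homomorphisms.
-- Now inj(G, G) = |Aut(G, x)|, and p ∤ |Aut(G, x)| by Cauchy's theorem (McKay's proof: rotate
-- the p-tuples of automorphisms with product 1) since (G, x) is p-rigid. Hence inj(G, H) ≢ 0
-- and likewise inj(H, G) ≢ 0, and injective homomorphisms both ways between finite structures
-- are isomorphisms.

open import Defs
open import Level using (0ℓ)
open import Data.Nat as ℕ using (ℕ; zero; suc; _+_; _*_; _^_; _∸_; _≤_; _<_; z≤n)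
open import Data.Nat.Base using (>-nonZero⁻¹; ≢-nonZero⁻¹; nonTrivial⇒≢1)
import Data.Nat.Properties as ℕ
open import Data.Nat.Properties
  using ( ≤-antisym; 1+n≰n; +-suc; +-comm; m≤n⇒m<n∨m≡n; m<n⇒0<n∸m; ≤-<-trans; m∸n≤m; m∸n+n≡m; <⇒≤; m<n+m
        ; module ≤-Reasoning)
open import Data.Nat.Divisibility using (_∣_; _∣0; ∣-refl; ∣m∣n⇒∣m+n; ∣m⇒∣m*n; ∣m+n∣m⇒∣n; ∣1⇒≡1)
open import Data.Nat.GeneralisedArithmetic using (fold; fold-+)
open import Data.Nat.GCD using (module Bézout)
open import Data.Nat.Coprimality using (coprime-Bézout; prime⇒coprime)
open import Data.Nat.Primality using (Prime; prime⇒nonZero; prime⇒nonTrivial)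
open import Data.Nat.Induction using (<-wellFounded)
open import Data.Integer as ℤ using (+_; _⊖_)
import Data.Integer.Properties as ℤ
import Data.Integer.Divisibility.Signed as ℤ∣
open import Data.Integer.Tactic.RingSolver using (solve-∀)
open import Data.Fin using (Fin; punchIn; punchOut) renaming (_≟_ to _≟ᶠ_)
import Data.Fin as Fin
open import Data.Fin.Properties using (punchIn-punchOut; punchOut-punchIn; punchOut-cong; punchInᵢ≢i)
open import Data.Vec using (Vec; []; _∷_; _∷ʳ_; lookup; tabulate; replicate; foldr′; toList)
import Data.Vec as Vec
import Data.Vec.Properties as VecP
open import Data.Vec.Relation.Binary.Equality.Cast using (cast-is-id)
open import Data.List
  using ( List; []; _∷_; [_]; _++_; map; length; filter; allFin; applyUpTo; concatMap
        ; cartesianProduct; cartesianProductWith)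
open import Data.List.Properties
  using ( length-map; length-++; length-applyUpTo; filter-notAll; filter-none; filter-≐
        ; map-concatMap; concatMap-cong; map-∘; ++-assoc; ++-identityʳ)
open import Data.List.Relation.Unary.All as All using (All; []; _∷_)
import Data.List.Relation.Unary.All.Properties as AllP
open import Data.List.Relation.Unary.Any as Any using (here; there)
open import Data.List.Relation.Unary.AllPairs using ([]; _∷_)
open import Data.List.Relation.Unary.Unique.Propositional using (Unique)
open import Data.List.Relation.Unary.Unique.Propositional.Properties
  using (allFin⁺; applyUpTo⁺₁; cartesianProductWith⁺; filter⁺)
open import Data.List.Membership.Propositional using (_∈_)
open import Data.List.Membership.Propositional.Properties
  using ( ∈-filter⁺; ∈-filter⁻; ∈-map⁺; ∈-map⁻; ∈-allFin; ∈-applyUpTo⁺; ∈-applyUpTo⁻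
        ; ∈-cartesianProduct⁺; ∈-cartesianProductWith⁺; ∈-cartesianProductWith⁻)
import Data.List.Membership.DecPropositional as DecMembership
open import Data.List.Relation.Binary.Subset.Propositional using (_⊆_)
import Data.Product as Product
open import Data.Product using (∃; _×_; _,_; proj₁; proj₂)
open import Data.Sum using (inj₁; inj₂)
open import Function using (_∘_; id)
open import Function.Bundles using (_⇔_; mk⇔)
open import Function.Definitions using (Injective)
open import Algebra.Structures using (IsMonoid)
open import Induction.WellFounded using (Acc; acc)
open import Relation.Binary.Definitions using (DecidableEquality)
open import Relation.Binary.PropositionalEquality hiding ([_])
open import Relation.Nullary using (¬_; Dec; yes; no; ¬?; contradiction)
open import Relation.Nullary.Decidable using (_×-dec_)
open import Relation.Unary using (Pred; Decidable; _≐_)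
open import Relation.Unary.Properties using (∁?)

module _ {A : Set} (_≟_ : DecidableEquality A) where

  Unique⇒length≤ : {xs ys : List A} → Unique xs → xs ⊆ ys → length xs ≤ length ys
  Unique⇒length≤ {[]}     _            _     = z≤n
  Unique⇒length≤ {x ∷ xs} {ys} (x∉xs ∷ uxs) xs⊆ys = begin-strict
    length xs                              ≤⟨ Unique⇒length≤ uxs xs⊆ys-x ⟩
    length (filter (λ y → ¬? (y ≟ x)) ys)  <⟨ filter-notAll _ ys x∈ys ⟩
    length ys                              ∎
    where
    open ≤-Reasoning
    x∈ys : Any.Any (λ y → ¬ (y ≢ x)) ys
    x∈ys = Any.map (λ x≡y y≢x → y≢x (sym x≡y)) (xs⊆ys (here refl))
    xs⊆ys-x : xs ⊆ filter (λ y → ¬? (y ≟ x)) ys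
    xs⊆ys-x z∈xs = ∈-filter⁺ _ (xs⊆ys (there z∈xs)) (λ z≡x → All.lookup x∉xs z∈xs (sym z≡x))

  Unique⇒length≡ : {xs ys : List A} → Unique xs → Unique ys → xs ⊆ ys → ys ⊆ xs → length xs ≡ length ys
  Unique⇒length≡ uxs uys xs⊆ys ys⊆xs = ≤-antisym (Unique⇒length≤ uxs xs⊆ys) (Unique⇒length≤ uys ys⊆xs)

InjectiveOn : {A B : Set} → (A → B) → List A → Set
InjectiveOn f xs = ∀ {x y} → x ∈ xs → y ∈ xs → f x ≡ f y → x ≡ y

Unique-map : {A B : Set} {f : A → B} {xs : List A} → InjectiveOn f xs → Unique xs → Unique (map f xs)
Unique-map {xs = []}         _   []           = []
Unique-map {f = f} {x ∷ xs} inj (x∉xs ∷ uxs) =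
  All.tabulate fx∉ ∷ Unique-map (λ y∈ z∈ → inj (there y∈) (there z∈)) uxs
  where
  fx∉ : ∀ {z} → z ∈ map f xs → f x ≢ z
  fx∉ z∈ fx≡z with ∈-map⁻ f z∈
  ... | y , y∈xs , refl = All.lookup x∉xs y∈xs (inj (here refl) (there y∈xs) fx≡z)

module _ {A B : Set} (_≟_ : DecidableEquality B) where

  bijectiveOn⇒length≡ : {xs : List A} {ys : List B} (f : A → B) → Unique xs → Unique ys →
    (∀ {x} → x ∈ xs → f x ∈ ys) → InjectiveOn f xs → (∀ {y} → y ∈ ys → ∃ λ x → x ∈ xs × f x ≡ y) →
    length xs ≡ length ys
  bijectiveOn⇒length≡ {xs} {ys} f uxs uys into inj onto = begin
    length xs          ≡⟨ length-map f xs ⟨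
    length (map f xs)  ≡⟨ Unique⇒length≡ _≟_ (Unique-map inj uxs) uys image⊆ys ys⊆image ⟩
    length ys          ∎
    where
    open ≡-Reasoning
    image⊆ys : map f xs ⊆ ys
    image⊆ys y∈ with ∈-map⁻ f y∈
    ... | x , x∈xs , refl = into x∈xs
    ys⊆image : ys ⊆ map f xs
    ys⊆image y∈ys with onto y∈ys
    ... | x , x∈xs , refl = ∈-map⁺ f x∈xs

module _ {A : Set} (_≟_ : DecidableEquality A) where
  open DecMembership _≟_ using (_∈?_)

  injectiveOn⇒surjectiveOn : {xs : List A} (f : A → A) → Unique xs → (∀ {x} → x ∈ xs → f x ∈ xs) →
    InjectiveOn f xs → ∀ {y} → y ∈ xs → ∃ λ x → x ∈ xs × f x ≡ y
  injectiveOn⇒surjectiveOn {xs} f uxs into inj {y} y∈xs with y ∈? map f xs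
  ... | yes y∈image with ∈-map⁻ f y∈image
  ...   | x , x∈xs , refl = x , x∈xs , refl
  injectiveOn⇒surjectiveOn {xs} f uxs into inj {y} y∈xs | no y∉image =
    contradiction (subst (_≤ length xs) (cong suc (length-map f xs)) (Unique⇒length≤ _≟_ unique y∷image⊆xs)) 1+n≰n
    where
    unique : Unique (y ∷ map f xs)
    unique = All.tabulate (λ z∈ y≡z → y∉image (subst (_∈ map f xs) (sym y≡z) z∈)) ∷ Unique-map inj uxs
    y∷image⊆xs : y ∷ map f xs ⊆ xs
    y∷image⊆xs (here refl) = y∈xs
    y∷image⊆xs (there z∈) with ∈-map⁻ f z∈
    ... | x , x∈xs , refl = into x∈xs

module _ {A : Set} {P : Pred A 0ℓ} (P? : Decidable P) where

  length-filter-∁ : (xs : List A) → length xs ≡ length (filter P? xs) + length (filter (∁? P?) xs)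
  length-filter-∁ []       = refl
  length-filter-∁ (x ∷ xs) with P? x
  ... | yes _ = cong suc (length-filter-∁ xs)
  ... | no  _ = trans (cong suc (length-filter-∁ xs)) (sym (+-suc _ _))

length-filter-map : ∀ {A B : Set} {P : B → Set} (P? : Decidable P) (f : A → B) xs →
  length (filter P? (map f xs)) ≡ length (filter (P? ∘ f) xs)
length-filter-map P? f []       = refl
length-filter-map P? f (x ∷ xs) with P? (f x)
... | yes _ = cong suc (length-filter-map P? f xs)
... | no  _ = length-filter-map P? f xs

module _ {A : Set} where

  vectors : List A → (k : ℕ) → List (Vec A k)
  vectors xs zero    = [ [] ]
  vectors xs (suc k) = cartesianProductWith _∷_ xs (vectors xs k)

  ∈-vectors-∷⁺ : {xs : List A} {k : ℕ} {x : A} {v : Vec A k} →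
    x ∈ xs → v ∈ vectors xs k → x ∷ v ∈ vectors xs (suc k)
  ∈-vectors-∷⁺ = ∈-cartesianProductWith⁺ _∷_

  ∈-vectors-∷⁻ : {xs : List A} {k : ℕ} {x : A} {v : Vec A k} →
    x ∷ v ∈ vectors xs (suc k) → x ∈ xs × v ∈ vectors xs k
  ∈-vectors-∷⁻ {xs} {k} x∷v∈ with ∈-cartesianProductWith⁻ _∷_ xs (vectors xs k) x∷v∈
  ... | _ , _ , x∈xs , v∈ , refl = x∈xs , v∈

  ∈-vectors⁺ : {xs : List A} {k : ℕ} {v : Vec A k} → (∀ i → lookup v i ∈ xs) → v ∈ vectors xs k
  ∈-vectors⁺ {v = []}    _    = here refl
  ∈-vectors⁺ {v = x ∷ v} v⊆xs = ∈-vectors-∷⁺ (v⊆xs Fin.zero) (∈-vectors⁺ (v⊆xs ∘ Fin.suc))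

  ∈-vectors⁻ : {xs : List A} {k : ℕ} {v : Vec A k} → v ∈ vectors xs k → ∀ i → lookup v i ∈ xs
  ∈-vectors⁻ {v = x ∷ v} x∷v∈ Fin.zero    = proj₁ (∈-vectors-∷⁻ x∷v∈)
  ∈-vectors⁻ {v = x ∷ v} x∷v∈ (Fin.suc i) = ∈-vectors⁻ (proj₂ (∈-vectors-∷⁻ x∷v∈)) i

  Unique-vectors : {xs : List A} (k : ℕ) → Unique xs → Unique (vectors xs k)
  Unique-vectors zero    _   = [] ∷ []
  Unique-vectors (suc k) uxs = cartesianProductWith⁺ _∷_ VecP.∷-injective uxs (Unique-vectors k uxs)

  length-vectors : (xs : List A) (k : ℕ) → length (vectors xs k) ≡ length xs ^ k
  length-vectors xs zero    = refl
  length-vectors xs (suc k) = trans (length-product xs) (cong (length xs *_) (length-vectors xs k))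
    where
    length-product : (ys : List A) →
      length (cartesianProductWith _∷_ ys (vectors xs k)) ≡ length ys * length (vectors xs k)
    length-product []       = refl
    length-product (y ∷ ys) = trans (length-++ (map (y ∷_) (vectors xs k)))
                                    (cong₂ _+_ (length-map (y ∷_) (vectors xs k)) (length-product ys))

lookup-ext : ∀ {A : Set} {k} {v w : Vec A k} → (∀ i → lookup v i ≡ lookup w i) → v ≡ w
lookup-ext {v = v} {w} v≗w =
  trans (sym (VecP.tabulate∘lookup v)) (trans (VecP.tabulate-cong v≗w) (VecP.tabulate∘lookup w))

Vec-map-injective : ∀ {A B : Set} {k} {f : A → B} → Injective _≡_ _≡_ f → Injective _≡_ _≡_ (Vec.map {n = k} f)
Vec-map-injective f-inj {[]}    {[]}    _     = refl
Vec-map-injective f-inj {x ∷ v} {y ∷ w} fv≡fw with VecP.∷-injective fv≡fw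
... | fx≡fy , fv≡fw′ = cong₂ _∷_ (f-inj fx≡fy) (Vec-map-injective f-inj fv≡fw′)

injective⇒surjective : ∀ {n} {f : Fin n → Fin n} → Injective _≡_ _≡_ f → ∀ y → ∃ λ x → f x ≡ y
injective⇒surjective {n} {f} f-inj y
  with injectiveOn⇒surjectiveOn _≟ᶠ_ f (allFin⁺ n) (λ _ → ∈-allFin _) (λ _ _ → f-inj) (∈-allFin y)
... | x , _ , fx≡y = x , fx≡y

-- Points of prime period

module _ {A : Set} (f : A → A) {x : A} where

  Period : ℕ → Set
  Period k = fold x f k ≡ x

  period-+ : ∀ {a b} → Period a → Period b → Period (a + b)
  period-+ {a} {b} pa pb = trans (fold-+ x f a) (trans (cong (λ y → fold y f a) pb) pa)

  period-∸ : ∀ {a b} → Period (a + b) → Period b → Period a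
  period-∸ {a} {b} pab pb = trans (cong (λ y → fold y f a) (sym pb)) (trans (sym (fold-+ x f a)) pab)

  period-* : ∀ c {a} → Period a → Period (c * a)
  period-* zero        pa = refl
  period-* (suc c) {a} pa = period-+ {a} {c * a} pa (period-* c pa)

  fixed⇒period : f x ≡ x → ∀ k → Period k
  fixed⇒period fx≡x zero    = refl
  fixed⇒period fx≡x (suc k) = trans (cong f (fixed⇒period fx≡x k)) fx≡x

  prime-period⇒fixed : ∀ {p k} → Prime p → 0 < k → k < p → Period k → Period p → f x ≡ x
  prime-period⇒fixed {p} {suc k} p-prime _ k<p pk pp with coprime-Bézout (prime⇒coprime p-prime k<p)
  ... | Bézout.+- a b 1+b[1+k]≡ap =
    period-∸ {1} {b * suc k} (subst Period (sym 1+b[1+k]≡ap) (period-* a pp)) (period-* b pk)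
  ... | Bézout.-+ a b 1+ap≡b[1+k] =
    period-∸ {1} {a * p} (subst Period (sym 1+ap≡b[1+k]) (period-* b pk)) (period-* a pp)

module _ {A : Set} (_≟_ : DecidableEquality A) (ρ : A → A) {p : ℕ} (p-prime : Prime p) where
  open DecMembership _≟_ using (_∈?_)

  private
    0<p : 0 < p
    0<p = >-nonZero⁻¹ p {{prime⇒nonZero p-prime}}

  periodic⇒fold-inverse : ∀ {y} → fold y ρ p ≡ y → fold (ρ y) ρ (p ∸ 1) ≡ y
  periodic⇒fold-inverse {y} y-periodic =
    trans (sym (fold-+ y ρ (p ∸ 1))) (trans (cong (fold y ρ) (m∸n+n≡m 0<p)) y-periodic)

  orbit : A → List A
  orbit x = applyUpTo (fold x ρ) p

  module _ {x : A} (x-periodic : fold x ρ p ≡ x) where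

    orbit-closed : ∀ {y} → y ∈ orbit x → ρ y ∈ orbit x
    orbit-closed y∈ with ∈-applyUpTo⁻ (fold x ρ) y∈
    ... | i , i<p , refl with m≤n⇒m<n∨m≡n i<p
    ...   | inj₁ 1+i<p = ∈-applyUpTo⁺ (fold x ρ) 1+i<p
    ...   | inj₂ refl  = subst (_∈ orbit x) (sym x-periodic) (∈-applyUpTo⁺ (fold x ρ) 0<p)

    fold-orbit-closed : ∀ {y} k → y ∈ orbit x → fold y ρ k ∈ orbit x
    fold-orbit-closed zero    y∈ = y∈
    fold-orbit-closed (suc k) y∈ = orbit-closed (fold-orbit-closed k y∈)

    orbit-closed⁻ : ∀ {y} → fold y ρ p ≡ y → ρ y ∈ orbit x → y ∈ orbit x
    orbit-closed⁻ y-periodic ρy∈ =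
      subst (_∈ orbit x) (periodic⇒fold-inverse y-periodic) (fold-orbit-closed (p ∸ 1) ρy∈)

    Unique-orbit : (∀ i → ρ (fold x ρ i) ≢ fold x ρ i) → Unique (orbit x)
    Unique-orbit moved = applyUpTo⁺₁ (fold x ρ) p distinct
      where
      distinct : ∀ {i j} → i < j → j < p → fold x ρ i ≢ fold x ρ j
      distinct {i} {j} i<j j<p xᵢ≡xⱼ =
        moved i (prime-period⇒fixed ρ p-prime (m<n⇒0<n∸m i<j) (≤-<-trans (m∸n≤m j i) j<p) period-j∸i period-p)
        where
        period-j∸i : fold (fold x ρ i) ρ (j ∸ i) ≡ fold x ρ i
        period-j∸i = trans (sym (fold-+ x ρ (j ∸ i))) (trans (cong (fold x ρ) (m∸n+n≡m (<⇒≤ i<j))) (sym xᵢ≡xⱼ))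
        period-p : fold (fold x ρ i) ρ p ≡ fold x ρ i
        period-p = trans (sym (fold-+ x ρ p))
                         (trans (cong (fold x ρ) (+-comm p i)) (trans (fold-+ x ρ i) (cong (λ z → fold z ρ i) x-periodic)))

  record Free (S : List A) : Set where
    field
      unique   : Unique S
      closed   : ∀ {y} → y ∈ S → ρ y ∈ S
      periodic : ∀ {y} → y ∈ S → fold y ρ p ≡ y
      moved    : ∀ {y} → y ∈ S → ρ y ≢ y

  -- S splits into orbits of length p: remove the orbit of the first element and recurse
  free⇒p∣length : ∀ {S} → Free S → p ∣ length S
  free⇒p∣length {S} free = go S (<-wellFounded (length S)) free
    where
    go : ∀ S → Acc _<_ (length S) → Free S → p ∣ length S
    go []      _        _    = p ∣0
    go (x ∷ S) (acc rs) free = subst (p ∣_) (sym length≡) (∣m∣n⇒∣m+n ∣-refl (go rest (rs rest<) free-rest))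
      where
      open Free free
      x∈ : x ∈ x ∷ S
      x∈ = here refl
      O : List A
      O = orbit x
      inO? : Decidable (_∈ O)
      inO? = _∈? O
      rest : List A
      rest = filter (∁? inO?) (x ∷ S)
      iterate-∈ : ∀ i → fold x ρ i ∈ x ∷ S
      iterate-∈ zero    = x∈
      iterate-∈ (suc i) = closed (iterate-∈ i)
      O⊆ : ∀ {y} → y ∈ O → y ∈ x ∷ S
      O⊆ y∈O with ∈-applyUpTo⁻ (fold x ρ) y∈O
      ... | i , _ , refl = iterate-∈ i
      length-inO : length (filter inO? (x ∷ S)) ≡ p
      length-inO = trans (Unique⇒length≡ _≟_ (filter⁺ inO? unique)
                                           (Unique-orbit (periodic x∈) (λ i → moved (iterate-∈ i)))
                                           (proj₂ ∘ ∈-filter⁻ inO?) (λ y∈O → ∈-filter⁺ inO? (O⊆ y∈O) y∈O))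
                         (length-applyUpTo (fold x ρ) p)
      length≡ : length (x ∷ S) ≡ p + length rest
      length≡ = trans (length-filter-∁ inO? (x ∷ S)) (cong (_+ length rest) length-inO)
      rest< : length rest < length (x ∷ S)
      rest< = subst (length rest <_) (sym length≡) (m<n+m (length rest) 0<p)
      free-rest : Free rest
      free-rest = record
        { unique   = filter⁺ (∁? inO?) unique
        ; closed   = λ y∈ → let y∈S , y∉O = ∈-filter⁻ (∁? inO?) y∈ in
                            ∈-filter⁺ (∁? inO?) (closed y∈S) (y∉O ∘ orbit-closed⁻ (periodic x∈) (periodic y∈S))
        ; periodic = periodic ∘ proj₁ ∘ ∈-filter⁻ (∁? inO?)
        ; moved    = moved ∘ proj₁ ∘ ∈-filter⁻ (∁? inO?)
        }

  moved? : Decidable (λ y → ρ y ≢ y)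
  moved? y = ¬? (ρ y ≟ y)

  p∣length-moved : ∀ {S} → Unique S → (∀ {y} → y ∈ S → ρ y ∈ S) →
    (∀ {y} → y ∈ S → fold y ρ p ≡ y) → p ∣ length (filter moved? S)
  p∣length-moved {S} unique closed periodic = free⇒p∣length (record
    { unique   = filter⁺ moved? unique
    ; closed   = λ y∈ → let y∈S , ρy≢y = ∈-filter⁻ moved? y∈ in
                        ∈-filter⁺ moved? (closed y∈S) (ρy≢y ∘ fixed⇐ρ-fixed (periodic y∈S))
    ; periodic = periodic ∘ proj₁ ∘ ∈-filter⁻ moved? {xs = S}
    ; moved    = proj₂ ∘ ∈-filter⁻ moved? {xs = S}
    })
    where
    fixed⇐ρ-fixed : ∀ {y} → fold y ρ p ≡ y → ρ (ρ y) ≡ ρ y → ρ y ≡ y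
    fixed⇐ρ-fixed {y} y-periodic ρρy≡ρy =
      trans (sym (fixed⇒period ρ ρρy≡ρy (p ∸ 1))) (periodic⇒fold-inverse y-periodic)

-- Cauchy's theorem, in McKay's proof

module _ {A : Set} where

  rotate : ∀ {k} → Vec A k → Vec A k
  rotate []       = []
  rotate (x ∷ xs) = xs ∷ʳ x

  private
    rotateL : List A → List A
    rotateL []       = []
    rotateL (x ∷ xs) = xs ++ [ x ]

    fold-rotateL : ∀ xs ys → fold (xs ++ ys) rotateL (length xs) ≡ ys ++ xs
    fold-rotateL []       ys = sym (++-identityʳ ys)
    fold-rotateL (x ∷ xs) ys = begin
      fold (x ∷ xs ++ ys) rotateL (suc (length xs))   ≡⟨ cong (fold (x ∷ xs ++ ys) rotateL) (+-comm 1 (length xs)) ⟩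
      fold (x ∷ xs ++ ys) rotateL (length xs + 1)     ≡⟨ fold-+ (x ∷ xs ++ ys) rotateL (length xs) ⟩
      fold ((xs ++ ys) ++ [ x ]) rotateL (length xs)  ≡⟨ cong (λ zs → fold zs rotateL (length xs)) (++-assoc xs ys [ x ]) ⟩
      fold (xs ++ ys ++ [ x ]) rotateL (length xs)    ≡⟨ fold-rotateL xs (ys ++ [ x ]) ⟩
      (ys ++ [ x ]) ++ xs                             ≡⟨ ++-assoc ys [ x ] xs ⟩
      ys ++ x ∷ xs                                    ∎
      where open ≡-Reasoning

    toList-fold-rotate : ∀ {k} n (v : Vec A k) → toList (fold v rotate n) ≡ fold (toList v) rotateL n
    toList-fold-rotate zero    v = refl
    toList-fold-rotate (suc n) v with fold v rotate n | toList-fold-rotate n v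
    ... | []    | ih = cong rotateL ih
    ... | x ∷ w | ih = trans (VecP.toList-∷ʳ x w) (cong rotateL ih)

  rotate-period : ∀ {k} (v : Vec A k) → fold v rotate k ≡ v
  rotate-period {k} v = trans (sym (cast-is-id refl _)) (VecP.toList-injective refl _ v (begin
    toList (fold v rotate k)                           ≡⟨ toList-fold-rotate k v ⟩
    fold (toList v) rotateL k                          ≡⟨ cong (fold (toList v) rotateL) (sym (VecP.length-toList v)) ⟩
    fold (toList v) rotateL (length (toList v))        ≡⟨ cong (λ xs → fold xs rotateL (length (toList v)))
                                                               (sym (++-identityʳ (toList v))) ⟩
    fold (toList v ++ []) rotateL (length (toList v))  ≡⟨ fold-rotateL (toList v) [] ⟩
    toList v                                           ∎))
    where open ≡-Reasoning

  rotate-fixed : ∀ {k} x (xs : Vec A k) → rotate (x ∷ xs) ≡ x ∷ xs → xs ≡ replicate k x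
  rotate-fixed x []       _  = refl
  rotate-fixed x (y ∷ xs) eq with VecP.∷-injectiveˡ eq
  ... | refl = cong (x ∷_) (rotate-fixed x xs (VecP.∷-injectiveʳ eq))

  rotate-replicate : ∀ k (x : A) → rotate (replicate k x) ≡ replicate k x
  rotate-replicate zero    x = refl
  rotate-replicate (suc k) x = snoc k
    where
    snoc : ∀ k → replicate k x ∷ʳ x ≡ x ∷ replicate k x
    snoc zero    = refl
    snoc (suc k) = cong (x ∷_) (snoc k)

  rotate-∈-vectors : ∀ {xs : List A} {k} {v : Vec A k} → v ∈ vectors xs k → rotate v ∈ vectors xs k
  rotate-∈-vectors {v = []}         v∈ = v∈
  rotate-∈-vectors {xs} {v = x ∷ w} v∈ =
    ∈-vectors⁺ (snoc-∈ w (∈-vectors⁻ {xs = xs} v∈ ∘ Fin.suc) (∈-vectors⁻ {xs = xs} v∈ Fin.zero))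
    where
    snoc-∈ : ∀ {xs k} (w : Vec A k) → (∀ i → lookup w i ∈ xs) → x ∈ xs → ∀ i → lookup (w ∷ʳ x) i ∈ xs
    snoc-∈ []      _    x∈ Fin.zero    = x∈
    snoc-∈ (y ∷ w) w⊆xs x∈ Fin.zero    = w⊆xs Fin.zero
    snoc-∈ (y ∷ w) w⊆xs x∈ (Fin.suc i) = snoc-∈ w (w⊆xs ∘ Fin.suc) x∈ i

module FiniteGroup {A : Set} (_≟_ : DecidableEquality A) {_∙_ : A → A → A} {ε : A} (monoid : IsMonoid _≡_ _∙_ ε)
  (G : List A) (G-unique : Unique G) (ε∈G : ε ∈ G) (∙-closed : ∀ {g h} → g ∈ G → h ∈ G → g ∙ h ∈ G)
  (inverse : ∀ {g} → g ∈ G → ∃ λ h → h ∈ G × h ∙ g ≡ ε)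
  where

  open IsMonoid monoid using (assoc; identityˡ; identityʳ)
  open ≡-Reasoning

  product : ∀ {k} → Vec A k → A
  product = foldr′ _∙_ ε

  product-∷ʳ : ∀ {k} (gs : Vec A k) g → product (gs ∷ʳ g) ≡ product gs ∙ g
  product-∷ʳ []       g = trans (identityʳ g) (sym (identityˡ g))
  product-∷ʳ (h ∷ gs) g = trans (cong (h ∙_) (product-∷ʳ gs g)) (sym (assoc h (product gs) g))

  product-∈ : ∀ {k} {gs : Vec A k} → gs ∈ vectors G k → product gs ∈ G
  product-∈ {gs = []}     _     = ε∈G
  product-∈ {gs = g ∷ gs} g∷gs∈ = let g∈ , gs∈ = ∈-vectors-∷⁻ g∷gs∈ in ∙-closed g∈ (product-∈ gs∈)

  product-replicate-ε : ∀ k → product (replicate k ε) ≡ ε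
  product-replicate-ε zero    = refl
  product-replicate-ε (suc k) = trans (cong (ε ∙_) (product-replicate-ε k)) (identityˡ ε)

  inverseʳ : ∀ {g h} → g ∈ G → h ∈ G → h ∙ g ≡ ε → g ∙ h ≡ ε
  inverseʳ {g} {h} g∈ h∈ hg≡ε with inverse h∈
  ... | h′ , _ , h′h≡ε = begin
    g ∙ h                ≡⟨ identityˡ (g ∙ h) ⟨
    ε ∙ (g ∙ h)          ≡⟨ cong (_∙ (g ∙ h)) h′h≡ε ⟨
    (h′ ∙ h) ∙ (g ∙ h)   ≡⟨ assoc h′ h (g ∙ h) ⟩
    h′ ∙ (h ∙ (g ∙ h))   ≡⟨ cong (h′ ∙_) (assoc h g h) ⟨
    h′ ∙ ((h ∙ g) ∙ h)   ≡⟨ cong (λ x → h′ ∙ (x ∙ h)) hg≡ε ⟩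
    h′ ∙ (ε ∙ h)         ≡⟨ cong (h′ ∙_) (identityˡ h) ⟩
    h′ ∙ h               ≡⟨ h′h≡ε ⟩
    ε                    ∎

  inverse-unique : ∀ {g h h′} → g ∈ G → h ∈ G → h ∙ g ≡ ε → h′ ∙ g ≡ ε → h ≡ h′
  inverse-unique {g} {h} {h′} g∈ h∈ hg≡ε h′g≡ε = begin
    h              ≡⟨ identityˡ h ⟨
    ε ∙ h          ≡⟨ cong (_∙ h) h′g≡ε ⟨
    (h′ ∙ g) ∙ h   ≡⟨ assoc h′ g h ⟩
    h′ ∙ (g ∙ h)   ≡⟨ cong (h′ ∙_) (inverseʳ g∈ h∈ hg≡ε) ⟩
    h′ ∙ ε         ≡⟨ identityʳ h′ ⟩
    h′             ∎

  module McKay {q : ℕ} (no-element-of-order-p : ∀ {g} → g ∈ G → product (replicate (suc q) g) ≡ ε → g ≡ ε) where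

    Cycles : List (Vec A (suc q))
    Cycles = filter (λ t → product t ≟ ε) (vectors G (suc q))

    ∈-Cycles⁻ : ∀ {t} → t ∈ Cycles → t ∈ vectors G (suc q) × product t ≡ ε
    ∈-Cycles⁻ = ∈-filter⁻ (λ t → product t ≟ ε) {xs = vectors G (suc q)}

    ∈-Cycles⁺ : ∀ {t} → t ∈ vectors G (suc q) → product t ≡ ε → t ∈ Cycles
    ∈-Cycles⁺ = ∈-filter⁺ (λ t → product t ≟ ε)

    Unique-Cycles : Unique Cycles
    Unique-Cycles = filter⁺ _ (Unique-vectors (suc q) G-unique)

    -- a cycle is determined by its tail, and every tail extends to a cycle
    length-Cycles : length Cycles ≡ length G ^ q
    length-Cycles = trans (bijectiveOn⇒length≡ (VecP.≡-dec _≟_) tail Unique-Cycles (Unique-vectors q G-unique)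
                                               into injective onto)
                          (length-vectors G q)
      where
      tail : Vec A (suc q) → Vec A q
      tail (g ∷ gs) = gs
      into : ∀ {t} → t ∈ Cycles → tail t ∈ vectors G q
      into {g ∷ gs} t∈ = proj₂ (∈-vectors-∷⁻ (proj₁ (∈-Cycles⁻ t∈)))
      injective : InjectiveOn tail Cycles
      injective {g ∷ gs} {g′ ∷ .gs} t∈ t′∈ refl =
        let g∈ , gs∈ = ∈-vectors-∷⁻ (proj₁ (∈-Cycles⁻ t∈)) in
        cong (_∷ gs) (inverse-unique (product-∈ gs∈) g∈ (proj₂ (∈-Cycles⁻ t∈)) (proj₂ (∈-Cycles⁻ t′∈)))
      onto : ∀ {gs} → gs ∈ vectors G q → ∃ λ t → t ∈ Cycles × tail t ≡ gs
      onto {gs} gs∈ with inverse (product-∈ gs∈)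
      ... | h , h∈ , hP≡ε = h ∷ gs , ∈-Cycles⁺ (∈-vectors-∷⁺ h∈ gs∈) hP≡ε , refl

    rotate-Cycles : ∀ {t} → t ∈ Cycles → rotate t ∈ Cycles
    rotate-Cycles {g ∷ gs} t∈ with ∈-Cycles⁻ t∈
    ... | t∈V , gP≡ε = let g∈ , gs∈ = ∈-vectors-∷⁻ {xs = G} t∈V in
      ∈-Cycles⁺ (rotate-∈-vectors {xs = G} t∈V) (trans (product-∷ʳ gs g) (inverseʳ (product-∈ gs∈) g∈ gP≡ε))

    fixed? : (t : Vec A (suc q)) → Dec (rotate t ≡ t)
    fixed? t = VecP.≡-dec _≟_ (rotate t) t

    length-fixed : length (filter fixed? Cycles) ≡ 1
    length-fixed = Unique⇒length≡ (VecP.≡-dec _≟_) (filter⁺ fixed? Unique-Cycles) ([] ∷ []) fixed⊆ ⊆fixed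
      where
      fixed⊆ : ∀ {t} → t ∈ filter fixed? Cycles → t ∈ [ replicate (suc q) ε ]
      fixed⊆ {g ∷ gs} t∈ with ∈-filter⁻ fixed? {xs = Cycles} t∈
      ... | t∈C , rotated with rotate-fixed g gs rotated
      ... | refl with ∈-Cycles⁻ t∈C
      ... | t∈V , P≡ε with no-element-of-order-p (proj₁ (∈-vectors-∷⁻ t∈V)) P≡ε
      ... | refl = here refl
      ⊆fixed : ∀ {t} → t ∈ [ replicate (suc q) ε ] → t ∈ filter fixed? Cycles
      ⊆fixed (here refl) =
        ∈-filter⁺ fixed? (∈-Cycles⁺ (∈-vectors⁺ (λ i → subst (_∈ G) (sym (VecP.lookup-replicate i ε)) ε∈G))
                                    (product-replicate-ε (suc q)))
                         (rotate-replicate (suc q) ε)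

  p∤order : ∀ {p} → Prime p → (∀ {g} → g ∈ G → product (replicate p g) ≡ ε → g ≡ ε) → ¬ p ∣ length G
  p∤order {zero}        p-prime _ _ = ≢-nonZero⁻¹ 0 {{prime⇒nonZero p-prime}} refl
  p∤order {suc zero}    p-prime _ _ = nonTrivial⇒≢1 {{prime⇒nonTrivial p-prime}} refl
  p∤order {suc (suc q)} p-prime no-order-p p∣|G| = nonTrivial⇒≢1 {{prime⇒nonTrivial p-prime}} (∣1⇒≡1 p∣1)
    where
    open McKay {suc q} no-order-p
    moved : ℕ
    moved = length (filter (∁? fixed?) Cycles)
    |G|^p-1≡ : length G ^ suc q ≡ moved + 1
    |G|^p-1≡ = begin
      length G ^ suc q                       ≡⟨ length-Cycles ⟨
      length Cycles                          ≡⟨ length-filter-∁ fixed? Cycles ⟩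
      length (filter fixed? Cycles) + moved  ≡⟨ cong (_+ moved) length-fixed ⟩
      1 + moved                              ≡⟨ +-comm 1 moved ⟩
      moved + 1                              ∎
    p∣moved : suc (suc q) ∣ moved
    p∣moved = p∣length-moved (VecP.≡-dec _≟_) rotate p-prime Unique-Cycles rotate-Cycles (λ {t} _ → rotate-period t)
    p∣1 : suc (suc q) ∣ 1
    p∣1 = ∣m+n∣m⇒∣n (subst (suc (suc q) ∣_) |G|^p-1≡ (∣m⇒∣m*n _ p∣|G|)) p∣moved

module _ {σ : Sig} {r : ℕ} where

  IsHom-resp : ∀ {K G : Str σ r} {f g} → (∀ x → f x ≡ g x) → IsHom K G f → IsHom K G g
  IsHom-resp {G = G} f≗g (preserves , fixes) =
    (λ i t t∈ → subst (_∈ rel G i) (VecP.map-cong f≗g t) (preserves i t t∈)) , (λ j → trans (sym (f≗g _)) (fixes j))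

  IsHom-∘ : ∀ {K G H : Str σ r} {f g} → IsHom K G f → IsHom G H g → IsHom K H (g ∘ f)
  IsHom-∘ {H = H} {f} {g} (f-preserves , f-fixes) (g-preserves , g-fixes) =
    (λ i t t∈ → subst (_∈ rel H i) (sym (VecP.map-∘ g f t)) (g-preserves i (Vec.map f t) (f-preserves i t t∈))) ,
    (λ j → trans (cong g (f-fixes j)) (g-fixes j))

  IsHom-id : ∀ {G : Str σ r} → IsHom G G id
  IsHom-id {G} = (λ i t t∈ → subst (_∈ rel G i) (sym (VecP.map-id t)) t∈) , (λ j → refl)

  -- h maps the finitely many tuples of each relation injectively into themselves, hence onto them
  injective-endo-reflects : ∀ (G : Str σ r) {h} → IsHom G G h → Injective _≡_ _≡_ h →
    ∀ i t → Vec.map h t ∈ rel G i → t ∈ rel G i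
  injective-endo-reflects G {h} (preserves , _) h-inj i t ht∈ =
    let t′ , t′∈R , ht′≡ht = onto (∈R⁺ ht∈) in
    subst (_∈ rel G i) (Vec-map-injective h-inj ht′≡ht) (∈R⁻ t′∈R)
    where
    _≟ᵗ_ : DecidableEquality (Vec (Fin (size G)) (arity σ i))
    _≟ᵗ_ = VecP.≡-dec _≟ᶠ_
    inRel? : (t : Vec (Fin (size G)) (arity σ i)) → Dec (t ∈ rel G i)
    inRel? t = DecMembership._∈?_ _≟ᵗ_ t (rel G i)
    R : List (Vec (Fin (size G)) (arity σ i))
    R = filter inRel? (vectors (allFin (size G)) (arity σ i))
    ∈R⁺ : ∀ {t} → t ∈ rel G i → t ∈ R
    ∈R⁺ = ∈-filter⁺ inRel? (∈-vectors⁺ (λ _ → ∈-allFin _))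
    ∈R⁻ : ∀ {t} → t ∈ R → t ∈ rel G i
    ∈R⁻ = proj₂ ∘ ∈-filter⁻ inRel? {xs = vectors (allFin (size G)) (arity σ i)}
    onto : ∀ {t} → t ∈ R → ∃ λ t′ → t′ ∈ R × Vec.map h t′ ≡ t
    onto = injectiveOn⇒surjectiveOn _≟ᵗ_ (Vec.map h) (filter⁺ inRel? (Unique-vectors _ (allFin⁺ _)))
             (λ t∈R → ∈R⁺ (preserves i _ (∈R⁻ t∈R))) (λ _ _ → Vec-map-injective h-inj)

  injective-homs⇒IsIso : ∀ {G H : Str σ r} {f g} →
    IsHom G H f → Injective _≡_ _≡_ f → IsHom H G g → Injective _≡_ _≡_ g → IsIso G H f
  injective-homs⇒IsIso {G} {H} {f} {g} f-hom f-inj g-hom g-inj =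
    (f-inj , surjective) , (λ i t → proj₁ f-hom i t , reflects i t) , proj₂ f-hom
    where
    surjective : ∀ y → ∃ λ x → ∀ {z} → z ≡ x → f z ≡ y
    surjective y with injective⇒surjective (g-inj ∘ f-inj) y
    ... | x , fgx≡y = g x , λ { refl → fgx≡y }
    reflects : ∀ i t → Vec.map f t ∈ rel H i → t ∈ rel G i
    reflects i t ft∈ = injective-endo-reflects G (IsHom-∘ f-hom g-hom) (f-inj ∘ g-inj) i t
      (subst (_∈ rel G i) (sym (VecP.map-∘ g f t)) (proj₁ g-hom i (Vec.map f t) ft∈))

  IsIso⇒inverse : ∀ {G H : Str σ r} {f} → IsIso G H f → ∃ λ g → IsHom H G g × (∀ y → f (g y) ≡ y)
  IsIso⇒inverse {G} {H} {f} ((f-inj , f-surj) , f-rel , f-fixes) = g , (preserves , fixes) , fg≗id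
    where
    g : Fin (size H) → Fin (size G)
    g y = proj₁ (f-surj y)
    fg≗id : ∀ y → f (g y) ≡ y
    fg≗id y = proj₂ (f-surj y) refl
    preserves : ∀ i t → t ∈ rel H i → Vec.map g t ∈ rel G i
    preserves i t t∈ = proj₂ (f-rel i (Vec.map g t))
      (subst (_∈ rel H i) (sym (trans (sym (VecP.map-∘ f g t)) (trans (VecP.map-cong fg≗id t) (VecP.map-id t)))) t∈)
    fixes : ∀ j → g (dist H j) ≡ dist G j
    fixes j = f-inj (trans (fg≗id (dist H j)) (sym (f-fixes j)))

  injective-endo-inverse : ∀ {G : Str σ r} {h} → IsHom G G h → Injective _≡_ _≡_ h →
    ∃ λ g → IsHom G G g × Injective _≡_ _≡_ g × (∀ x → g (h x) ≡ x)
  injective-endo-inverse {G} {h} h-hom h-inj with IsIso⇒inverse (injective-homs⇒IsIso h-hom h-inj h-hom h-inj)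
  ... | g , g-hom , hg≗id = g , g-hom , g-inj , (λ x → h-inj (hg≗id (h x)))
    where
    g-inj : Injective _≡_ _≡_ g
    g-inj {x} {y} gx≡gy = trans (sym (hg≗id x)) (trans (cong h gx≡gy) (hg≗id y))

-- Counting homomorphisms that separate given pairs of vertices

allFuns-tabulate : ∀ k m → map tabulate (allFuns k m) ≡ vectors (allFin m) k
allFuns-tabulate zero    m = refl
allFuns-tabulate (suc k) m = begin
  map tabulate (allFuns (suc k) m)
    ≡⟨ map-concatMap tabulate _ (allFin m) ⟩
  concatMap (λ a → map tabulate (map _ (allFuns k m))) (allFin m)
    ≡⟨ concatMap-cong (λ a → trans (sym (map-∘ (allFuns k m)))
                                   (trans (map-∘ (allFuns k m)) (cong (map (a ∷_)) (allFuns-tabulate k m))))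
                      (allFin m) ⟩
  concatMap (λ a → map (a ∷_) (vectors (allFin m) k)) (allFin m)
    ≡⟨ concatMap≡cartesianProductWith (allFin m) ⟩
  vectors (allFin m) (suc k)
    ∎
  where
  open ≡-Reasoning
  concatMap≡cartesianProductWith : ∀ xs →
    concatMap (λ a → map (a ∷_) (vectors (allFin m) k)) xs ≡ cartesianProductWith _∷_ xs (vectors (allFin m) k)
  concatMap≡cartesianProductWith []       = refl
  concatMap≡cartesianProductWith (x ∷ xs) = cong (map (x ∷_) (vectors (allFin m) k) ++_) (concatMap≡cartesianProductWith xs)

Separates : ∀ {k} {B : Set} → List (Fin k × Fin k) → (Fin k → B) → Set
Separates D f = All (λ (a , b) → f a ≢ f b) D

separates? : ∀ {k m} (D : List (Fin k × Fin k)) (f : Fin k → Fin m) → Dec (Separates D f)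
separates? D f = All.all? (λ (a , b) → ¬? (f a ≟ᶠ f b)) D

Separates-resp : ∀ {k} {B : Set} {D : List (Fin k × Fin k)} {f g : Fin k → B} →
  (∀ x → f x ≡ g x) → Separates D f → Separates D g
Separates-resp f≗g = All.map (λ {(a , b)} fa≢fb ga≡gb → fa≢fb (trans (f≗g a) (trans ga≡gb (sym (f≗g b)))))

distinct? : ∀ {k} (ab : Fin k × Fin k) → Dec (proj₁ ab ≢ proj₂ ab)
distinct? (a , b) = ¬? (a ≟ᶠ b)

distinctPairs : (k : ℕ) → List (Fin k × Fin k)
distinctPairs k = filter distinct? (cartesianProduct (allFin k) (allFin k))

module _ {k : ℕ} {B : Set} {f : Fin k → B} where

  Separates-distinctPairs⇒injective : Separates (distinctPairs k) f → Injective _≡_ _≡_ f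
  Separates-distinctPairs⇒injective f-sep {a} {b} fa≡fb with a ≟ᶠ b
  ... | yes a≡b = a≡b
  ... | no  a≢b = contradiction fa≡fb
                    (All.lookup f-sep (∈-filter⁺ distinct? (∈-cartesianProduct⁺ (∈-allFin a) (∈-allFin b)) a≢b))

  injective⇒Separates-distinctPairs : Injective _≡_ _≡_ f → Separates (distinctPairs k) f
  injective⇒Separates-distinctPairs f-inj =
    All.tabulate λ ab∈ → proj₂ (∈-filter⁻ distinct? {xs = cartesianProduct (allFin k) (allFin k)} ab∈) ∘ f-inj

module _ {σ : Sig} {r : ℕ} where

  Pairs : Str σ r → Set
  Pairs K = List (Fin (size K) × Fin (size K))

  -- maps are enumerated as vectors, whose equality (unlike that of functions) is decidable
  separatingHoms : (K G : Str σ r) → Pairs K → List (Vec (Fin (size G)) (size K))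
  separatingHoms K G D =
    filter (λ v → isHom? K G (lookup v) ×-dec separates? D (lookup v)) (vectors (allFin (size G)) (size K))

  hom≢ : (K G : Str σ r) → Pairs K → ℕ
  hom≢ K G D = length (separatingHoms K G D)

  module _ {K G : Str σ r} {D : Pairs K} where

    ∈-separatingHoms⁺ : ∀ {v} → IsHom K G (lookup v) → Separates D (lookup v) → v ∈ separatingHoms K G D
    ∈-separatingHoms⁺ v-hom v-sep = ∈-filter⁺ _ (∈-vectors⁺ (λ _ → ∈-allFin _)) (v-hom , v-sep)

    ∈-separatingHoms⁻ : ∀ {v} → v ∈ separatingHoms K G D → IsHom K G (lookup v) × Separates D (lookup v)
    ∈-separatingHoms⁻ = proj₂ ∘ ∈-filter⁻ _ {xs = vectors (allFin (size G)) (size K)}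

    Unique-separatingHoms : Unique (separatingHoms K G D)
    Unique-separatingHoms = filter⁺ _ (Unique-vectors (size K) (allFin⁺ (size G)))

  hom≡hom≢[] : (K G : Str σ r) → hom K G ≡ hom≢ K G []
  hom≡hom≢[] K G = begin
    length (filter (isHom? K G) (allFuns k m))              ≡⟨ cong length (filter-≐ _ _ hom⇔ (allFuns k m)) ⟩
    length (filter (isHomVec? ∘ tabulate) (allFuns k m))    ≡⟨ length-filter-map isHomVec? tabulate (allFuns k m) ⟨
    length (filter isHomVec? (map tabulate (allFuns k m)))  ≡⟨ cong (length ∘ filter isHomVec?) (allFuns-tabulate k m) ⟩
    hom≢ K G []                                             ∎
    where
    open ≡-Reasoning
    k m : ℕ
    k = size K
    m = size G
    isHomVec? : (v : Vec (Fin m) k) → Dec (IsHom K G (lookup v) × Separates [] (lookup v))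
    isHomVec? v = isHom? K G (lookup v) ×-dec separates? [] (lookup v)
    hom⇔ : IsHom K G ≐ (λ f → IsHom K G (lookup (tabulate f)) × Separates [] (lookup (tabulate f)))
    hom⇔ = (λ {f} f-hom → IsHom-resp (λ x → sym (VecP.lookup∘tabulate f x)) f-hom , [])
         , (λ {f} (v-hom , _) → IsHom-resp (VecP.lookup∘tabulate f) v-hom)

  ≅⇒hom≡ : ∀ {G H : Str σ r} → G ≅ H → ∀ K → hom K G ≡ hom K H
  ≅⇒hom≡ {G} {H} (φ , φ-iso@((φ-inj , _) , φ-rel , φ-fixes)) K with IsIso⇒inverse φ-iso
  ... | ψ , ψ-hom , φψ≗id = begin
    hom K G      ≡⟨ hom≡hom≢[] K G ⟩
    hom≢ K G []  ≡⟨ bijectiveOn⇒length≡ (VecP.≡-dec _≟ᶠ_) (Vec.map φ) Unique-separatingHoms Unique-separatingHoms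
                                         into (λ _ _ → Vec-map-injective φ-inj) onto ⟩
    hom≢ K H []  ≡⟨ hom≡hom≢[] K H ⟨
    hom K H      ∎
    where
    open ≡-Reasoning
    φ-hom : IsHom G H φ
    φ-hom = (λ i t → proj₁ (φ-rel i t)) , φ-fixes
    map-hom : ∀ {L M : Str σ r} {f : Fin (size L) → Fin (size M)} (v : Vec (Fin (size L)) (size K)) →
      IsHom K L (lookup v) → IsHom L M f → IsHom K M (lookup (Vec.map f v))
    map-hom {f = f} v v-hom f-hom = IsHom-resp (λ x → sym (VecP.lookup-map x f v)) (IsHom-∘ v-hom f-hom)
    into : ∀ {v} → v ∈ separatingHoms K G [] → Vec.map φ v ∈ separatingHoms K H []
    into {v} v∈ = ∈-separatingHoms⁺ (map-hom v (proj₁ (∈-separatingHoms⁻ v∈)) φ-hom) []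
    onto : ∀ {w} → w ∈ separatingHoms K H [] → ∃ λ v → v ∈ separatingHoms K G [] × Vec.map φ v ≡ w
    onto {w} w∈ = Vec.map ψ w , ∈-separatingHoms⁺ (map-hom w (proj₁ (∈-separatingHoms⁻ w∈)) ψ-hom) [] ,
                  trans (sym (VecP.map-∘ φ ψ w)) (trans (VecP.map-cong φψ≗id w) (VecP.map-id w))

  hom≢-diagonal : ∀ (K L : Str σ r) a D → hom≢ K L ((a , a) ∷ D) ≡ 0
  hom≢-diagonal K L a D =
    cong length (filter-none _ {xs = vectors (allFin (size L)) (size K)} (All.tabulate (λ _ (_ , sep) → All.head sep refl)))

-- Deletion and contraction of a pair of vertices

module _ {n : ℕ} (u v : Fin (suc n)) (u≢v : u ≢ v) where

  private
    redirect : Fin (suc n) → Fin (suc n)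
    redirect w with w ≟ᶠ v
    ... | yes _ = u
    ... | no  _ = w

    v≢redirect : ∀ w → v ≢ redirect w
    v≢redirect w with w ≟ᶠ v
    ... | yes _   = u≢v ∘ sym
    ... | no  w≢v = w≢v ∘ sym

    redirect-punchIn : ∀ j → redirect (punchIn v j) ≡ punchIn v j
    redirect-punchIn j with punchIn v j ≟ᶠ v
    ... | yes eq = contradiction eq (punchInᵢ≢i v j)
    ... | no  _  = refl

  -- the quotient map identifying v with u; punchIn v is a section of it
  merge : Fin (suc n) → Fin n
  merge w = punchOut (v≢redirect w)

  merge-punchIn : ∀ j → merge (punchIn v j) ≡ j
  merge-punchIn j = trans (punchOut-cong v (redirect-punchIn j)) (punchOut-punchIn v)

  merge-u≡merge-v : merge u ≡ merge v
  merge-u≡merge-v = punchOut-cong v (trans redirect-u (sym redirect-v))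
    where
    redirect-u : redirect u ≡ u
    redirect-u with u ≟ᶠ v
    ... | yes u≡v = contradiction u≡v u≢v
    ... | no  _   = refl
    redirect-v : redirect v ≡ u
    redirect-v with v ≟ᶠ v
    ... | yes _   = refl
    ... | no  v≢v = contradiction refl v≢v

  factor-through-merge : ∀ {B : Set} (f : Fin (suc n) → B) → f u ≡ f v → ∀ w → f (punchIn v (merge w)) ≡ f w
  factor-through-merge f fu≡fv w = trans (cong f (punchIn-punchOut (v≢redirect w))) (f-redirect w)
    where
    f-redirect : ∀ w → f (redirect w) ≡ f w
    f-redirect w with w ≟ᶠ v
    ... | yes refl = fu≡fv
    ... | no  _    = refl

module _ {σ : Sig} {r : ℕ} where

  module DeletionContraction {n : ℕ} (R : (i : Fin (nrel σ)) → List (Vec (Fin (suc n)) (arity σ i)))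
    (d : Fin r → Fin (suc n)) {u v : Fin (suc n)} (u≢v : u ≢ v) where

    private
      q : Fin (suc n) → Fin n
      q = merge u v u≢v
      factor : ∀ {B : Set} (f : Fin (suc n) → B) → f u ≡ f v → ∀ w → f (punchIn v (q w)) ≡ f w
      factor = factor-through-merge u v u≢v

    K : Str σ r
    K = record { size = suc n ; rel = R ; dist = d }

    K/uv : Str σ r
    K/uv = record { size = n ; rel = λ i → map (Vec.map q) (R i) ; dist = q ∘ d }

    _/uv : Pairs K → Pairs K/uv
    _/uv = map (Product.map q q)

    IsHom-merge : ∀ {G : Str σ r} {w} → IsHom K/uv G w → IsHom K G (w ∘ q)
    IsHom-merge {G} {w} (preserves , fixes) =
      (λ i t t∈ → subst (_∈ rel G i) (sym (VecP.map-∘ w q t)) (preserves i (Vec.map q t) (∈-map⁺ (Vec.map q) t∈)))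
      , fixes

    IsHom-punchIn : ∀ {G : Str σ r} {f} → IsHom K G f → f u ≡ f v → IsHom K/uv G (f ∘ punchIn v)
    IsHom-punchIn {G} {f} (preserves , fixes) fu≡fv = preserves′ , (λ j → trans (factor f fu≡fv (d j)) (fixes j))
      where
      preserves′ : ∀ i t → t ∈ rel K/uv i → Vec.map (f ∘ punchIn v) t ∈ rel G i
      preserves′ i t t∈ with ∈-map⁻ (Vec.map q) t∈
      ... | t₀ , t₀∈ , refl =
        subst (_∈ rel G i) (trans (sym (VecP.map-cong (factor f fu≡fv) t₀)) (VecP.map-∘ (f ∘ punchIn v) q t₀))
              (preserves i t₀ t₀∈)

    lift : ∀ {m} → Vec (Fin m) n → Vec (Fin m) (suc n)
    lift w = tabulate (lookup w ∘ q)

    lookup-lift : ∀ {m} (w : Vec (Fin m) n) x → lookup (lift w) x ≡ lookup w (q x)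
    lookup-lift w = VecP.lookup∘tabulate (lookup w ∘ q)

    lift-injective : ∀ {m} {w w′ : Vec (Fin m) n} → lift w ≡ lift w′ → w ≡ w′
    lift-injective {w = w} {w′} eq = lookup-ext λ j → begin
      lookup w j                      ≡⟨ cong (lookup w) (merge-punchIn u v u≢v j) ⟨
      lookup w (q (punchIn v j))      ≡⟨ lookup-lift w (punchIn v j) ⟨
      lookup (lift w) (punchIn v j)   ≡⟨ cong (λ f → lookup f (punchIn v j)) eq ⟩
      lookup (lift w′) (punchIn v j)  ≡⟨ lookup-lift w′ (punchIn v j) ⟩
      lookup w′ (q (punchIn v j))     ≡⟨ cong (lookup w′) (merge-punchIn u v u≢v j) ⟩
      lookup w′ j                     ∎
      where open ≡-Reasoning

    module _ (G : Str σ r) (D : Pairs K) where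

      identifies? : (f : Vec (Fin (size G)) (suc n)) → Dec (lookup f u ≡ lookup f v)
      identifies? f = lookup f u ≟ᶠ lookup f v

      Identifying : List (Vec (Fin (size G)) (suc n))
      Identifying = filter identifies? (separatingHoms K G D)

      ∈-Identifying⁻ : ∀ {f} → f ∈ Identifying →
        (IsHom K G (lookup f) × Separates D (lookup f)) × lookup f u ≡ lookup f v
      ∈-Identifying⁻ f∈ =
        let f∈S , fu≡fv = ∈-filter⁻ identifies? {xs = separatingHoms K G D} f∈ in ∈-separatingHoms⁻ f∈S , fu≡fv

      contracted-count : hom≢ K/uv G (D /uv) ≡ length Identifying
      contracted-count =
        bijectiveOn⇒length≡ (VecP.≡-dec _≟ᶠ_) lift Unique-separatingHoms (filter⁺ identifies? Unique-separatingHoms)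
                            into (λ _ _ → lift-injective) onto
        where
        into : ∀ {w} → w ∈ separatingHoms K/uv G (D /uv) → lift w ∈ Identifying
        into {w} w∈ = let w-hom , w-sep = ∈-separatingHoms⁻ w∈ in
          ∈-filter⁺ identifies?
            (∈-separatingHoms⁺ (IsHom-resp {K = K} (λ x → sym (lookup-lift w x)) (IsHom-merge w-hom))
                               (Separates-resp (λ x → sym (lookup-lift w x)) (AllP.map⁻ w-sep)))
            (trans (lookup-lift w u) (trans (cong (lookup w) (merge-u≡merge-v u v u≢v)) (sym (lookup-lift w v))))
        onto : ∀ {f} → f ∈ Identifying → ∃ λ w → w ∈ separatingHoms K/uv G (D /uv) × lift w ≡ f
        onto {f} f∈ = let (f-hom , f-sep) , fu≡fv = ∈-Identifying⁻ f∈ in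
          w , ∈-separatingHoms⁺ (IsHom-resp {K = K/uv} (λ x → sym (lookup-w x)) (IsHom-punchIn f-hom fu≡fv))
                                (AllP.map⁺ (Separates-resp (λ x → trans (sym (factor (lookup f) fu≡fv x))
                                                                         (sym (lookup-w (q x)))) f-sep))
            , lookup-ext (λ x → trans (lookup-lift w x) (trans (lookup-w (q x)) (factor (lookup f) fu≡fv x)))
          where
          w : Vec (Fin (size G)) n
          w = tabulate (lookup f ∘ punchIn v)
          lookup-w : ∀ j → lookup w j ≡ lookup f (punchIn v j)
          lookup-w = VecP.lookup∘tabulate (lookup f ∘ punchIn v)

      deletion-contraction : hom≢ K G D ≡ hom≢ K G ((u , v) ∷ D) + hom≢ K/uv G (D /uv)
      deletion-contraction = begin
        hom≢ K G D                                    ≡⟨ length-filter-∁ identifies? (separatingHoms K G D) ⟩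
        length Identifying + length Separating        ≡⟨ +-comm (length Identifying) (length Separating) ⟩
        length Separating + length Identifying        ≡⟨ cong₂ _+_ separating-count (sym contracted-count) ⟩
        hom≢ K G ((u , v) ∷ D) + hom≢ K/uv G (D /uv)  ∎
        where
        open ≡-Reasoning
        Separating : List (Vec (Fin (size G)) (suc n))
        Separating = filter (∁? identifies?) (separatingHoms K G D)
        separating-count : length Separating ≡ hom≢ K G ((u , v) ∷ D)
        separating-count =
          Unique⇒length≡ (VecP.≡-dec _≟ᶠ_) (filter⁺ (∁? identifies?) Unique-separatingHoms) Unique-separatingHoms
            (λ f∈ → let f∈S , fu≢fv = ∈-filter⁻ (∁? identifies?) {xs = separatingHoms K G D} f∈
                        f-hom , f-sep = ∈-separatingHoms⁻ f∈S in
                    ∈-separatingHoms⁺ f-hom (fu≢fv ∷ f-sep))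
            (λ f∈ → let f-hom , f-sep = ∈-separatingHoms⁻ f∈ in
                    ∈-filter⁺ (∁? identifies?) (∈-separatingHoms⁺ f-hom (All.tail f-sep)) (All.head f-sep))

∣m⊖n∣≡∣m-n∣ : ∀ m n → ℤ.∣ m ⊖ n ∣ ≡ ℕ.∣ m - n ∣
∣m⊖n∣≡∣m-n∣ m n with ℕ.≤-total m n
... | inj₁ m≤n = trans (ℤ.∣⊖∣-≤ m≤n) (sym (ℕ.m≤n⇒∣m-n∣≡n∸m m≤n))
... | inj₂ n≤m = trans (ℤ.∣m⊖n∣≡∣n⊖m∣ m n)
                       (trans (ℤ.∣⊖∣-≤ n≤m) (trans (sym (ℕ.m≤n⇒∣m-n∣≡n∸m n≤m)) (ℕ.∣-∣-comm n m)))

mod⇒∣⊖ : ∀ {p} a b → a ≡ b [mod p ] → (+ p) ℤ∣.∣ (a ⊖ b)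
mod⇒∣⊖ {p} a b p∣∣a-b∣ = ℤ∣.∣ᵤ⇒∣ (subst (p ∣_) (sym (∣m⊖n∣≡∣m-n∣ a b)) p∣∣a-b∣)

∣⊖⇒mod : ∀ {p} a b → (+ p) ℤ∣.∣ (a ⊖ b) → a ≡ b [mod p ]
∣⊖⇒mod {p} a b p∣a⊖b = subst (p ∣_) (∣m⊖n∣≡∣m-n∣ a b) (ℤ∣.∣⇒∣ᵤ p∣a⊖b)

mod-refl : ∀ {p} a → a ≡ a [mod p ]
mod-refl {p} a = subst (p ∣_) (sym (ℕ.∣n-n∣≡0 a)) (p ∣0)

mod-sym : ∀ {p} a b → a ≡ b [mod p ] → b ≡ a [mod p ]
mod-sym {p} a b = subst (p ∣_) (ℕ.∣-∣-comm a b)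

mod-cancelʳ-+ : ∀ {p a b c d} → (a + c) ≡ (b + d) [mod p ] → c ≡ d [mod p ] → a ≡ b [mod p ]
mod-cancelʳ-+ {p} {a} {b} {c} {d} a+c≡b+d c≡d =
  ∣⊖⇒mod a b (ℤ∣.∣m+n∣n⇒∣m (subst ((+ p) ℤ∣.∣_) split (mod⇒∣⊖ (a + c) (b + d) a+c≡b+d))
                            (mod⇒∣⊖ c d c≡d))
  where
  interchange : ∀ x y z w → (x ℤ.+ y) ℤ.- (z ℤ.+ w) ≡ (x ℤ.- z) ℤ.+ (y ℤ.- w)
  interchange = solve-∀
  split : (a + c) ⊖ (b + d) ≡ (a ⊖ b) ℤ.+ (c ⊖ d)
  split = begin
    (a + c) ⊖ (b + d)                ≡⟨ ℤ.[+m]-[+n]≡m⊖n (a + c) (b + d) ⟨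
    + (a + c) ℤ.- + (b + d)          ≡⟨ cong₂ ℤ._-_ (ℤ.pos-+ a c) (ℤ.pos-+ b d) ⟩
    (+ a ℤ.+ + c) ℤ.- (+ b ℤ.+ + d)  ≡⟨ interchange (+ a) (+ c) (+ b) (+ d) ⟩
    (+ a ℤ.- + b) ℤ.+ (+ c ℤ.- + d)  ≡⟨ cong₂ ℤ._+_ (ℤ.[+m]-[+n]≡m⊖n a b) (ℤ.[+m]-[+n]≡m⊖n c d) ⟩
    (a ⊖ b) ℤ.+ (c ⊖ d)              ∎
    where open ≡-Reasoning

module _ {σ : Sig} {r : ℕ} {G H : Str σ r} {p : ℕ} (hom≡ : ∀ K → hom K G ≡ hom K H [mod p ]) where

  private
    Congruent : Str σ r → Set
    Congruent K = ∀ D → hom≢ K G D ≡ hom≢ K H D [mod p ]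

    congruent-∷ : ∀ {n} R d (D : List (Fin (suc n) × Fin (suc n))) a b →
      (∀ R′ d′ → Congruent (record { size = n ; rel = R′ ; dist = d′ })) →
      let K = record { size = suc n ; rel = R ; dist = d } in
      hom≢ K G D ≡ hom≢ K H D [mod p ] → hom≢ K G ((a , b) ∷ D) ≡ hom≢ K H ((a , b) ∷ D) [mod p ]
    congruent-∷ {n} R d D a b contractions-congruent D-congruent with a ≟ᶠ b
    ... | yes refl = subst₂ (_≡_[mod p ]) (sym (hom≢-diagonal K G a D)) (sym (hom≢-diagonal K H a D)) (mod-refl 0)
      where
      K : Str σ r
      K = record { size = suc n ; rel = R ; dist = d }
    ... | no  a≢b  =
      mod-cancelʳ-+ {a = hom≢ K G ((a , b) ∷ D)} {hom≢ K H ((a , b) ∷ D)} {hom≢ K/uv G (D /uv)} {hom≢ K/uv H (D /uv)}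
        (subst₂ (_≡_[mod p ]) (deletion-contraction G D) (deletion-contraction H D) D-congruent)
        (contractions-congruent (rel K/uv) (dist K/uv) (D /uv))
      where open DeletionContraction R d a≢b

    congruent : ∀ k R d → Congruent (record { size = k ; rel = R ; dist = d })
    congruent k       R d []            = subst₂ (_≡_[mod p ]) (hom≡hom≢[] K G) (hom≡hom≢[] K H) (hom≡ K)
      where
      K : Str σ r
      K = record { size = k ; rel = R ; dist = d }
    congruent zero    R d ((() , _) ∷ D)
    congruent (suc n) R d ((a , b) ∷ D) = congruent-∷ R d D a b (congruent n) (congruent (suc n) R d D)

  hom≢-congruent : ∀ K D → hom≢ K G D ≡ hom≢ K H D [mod p ]
  hom≢-congruent K = congruent (size K) (rel K) (dist K)

module _ {n : ℕ} where

  infixr 9 _⊙_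
  _⊙_ : Vec (Fin n) n → Vec (Fin n) n → Vec (Fin n) n
  f ⊙ g = tabulate (lookup f ∘ lookup g)

  lookup-⊙ : ∀ f g x → lookup (f ⊙ g) x ≡ lookup f (lookup g x)
  lookup-⊙ f g = VecP.lookup∘tabulate (lookup f ∘ lookup g)

  ⊙-isMonoid : IsMonoid _≡_ _⊙_ (Vec.allFin n)
  ⊙-isMonoid = record
    { isSemigroup = record
      { isMagma = record { isEquivalence = isEquivalence ; ∙-cong = cong₂ _⊙_ }
      ; assoc   = λ f g h → lookup-ext λ x →
                    trans (trans (lookup-⊙ (f ⊙ g) h x) (lookup-⊙ f g (lookup h x)))
                          (sym (trans (lookup-⊙ f (g ⊙ h) x) (cong (lookup f) (lookup-⊙ g h x))))
      }
    ; identity = (λ f → lookup-ext λ x → trans (lookup-⊙ (Vec.allFin n) f x) (VecP.lookup-allFin (lookup f x)))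
               , (λ f → lookup-ext λ x → trans (lookup-⊙ f (Vec.allFin n) x) (cong (lookup f) (VecP.lookup-allFin x)))
    }

module _ {σ : Sig} {r : ℕ} (G : Str σ r) where

  private
    n : ℕ
    n = size G

  automorphisms : List (Vec (Fin n) n)
  automorphisms = separatingHoms G G (distinctPairs n)

  ∈-automorphisms⁻ : ∀ {g} → g ∈ automorphisms → IsHom G G (lookup g) × Injective _≡_ _≡_ (lookup g)
  ∈-automorphisms⁻ g∈ = let g-hom , g-sep = ∈-separatingHoms⁻ g∈ in g-hom , Separates-distinctPairs⇒injective g-sep

  ∈-automorphisms⁺ : ∀ {g} → IsHom G G (lookup g) → Injective _≡_ _≡_ (lookup g) → g ∈ automorphisms
  ∈-automorphisms⁺ g-hom g-inj = ∈-separatingHoms⁺ g-hom (injective⇒Separates-distinctPairs g-inj)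

  allFin∈automorphisms : Vec.allFin n ∈ automorphisms
  allFin∈automorphisms =
    ∈-automorphisms⁺ (IsHom-resp (λ x → sym (VecP.lookup-allFin x)) IsHom-id)
                     (λ {x} {y} eq → trans (sym (VecP.lookup-allFin x)) (trans eq (VecP.lookup-allFin y)))

  ⊙-closed : ∀ {f g} → f ∈ automorphisms → g ∈ automorphisms → f ⊙ g ∈ automorphisms
  ⊙-closed {f} {g} f∈ g∈ =
    let f-hom , f-inj = ∈-automorphisms⁻ f∈
        g-hom , g-inj = ∈-automorphisms⁻ g∈ in
    ∈-automorphisms⁺ (IsHom-resp (λ x → sym (lookup-⊙ f g x)) (IsHom-∘ g-hom f-hom))
                     (λ {x} {y} eq → g-inj (f-inj (trans (sym (lookup-⊙ f g x)) (trans eq (lookup-⊙ f g y)))))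

  ⊙-inverse : ∀ {g} → g ∈ automorphisms → ∃ λ h → h ∈ automorphisms × h ⊙ g ≡ Vec.allFin n
  ⊙-inverse {g} g∈ with injective-endo-inverse (proj₁ (∈-automorphisms⁻ g∈)) (proj₂ (∈-automorphisms⁻ g∈))
  ... | h , h-hom , h-inj , hg≗id =
    tabulate h ,
    ∈-automorphisms⁺ (IsHom-resp (λ x → sym (VecP.lookup∘tabulate h x)) h-hom)
                     (λ {x} {y} eq → h-inj (trans (sym (VecP.lookup∘tabulate h x)) (trans eq (VecP.lookup∘tabulate h y)))) ,
    lookup-ext (λ x → trans (lookup-⊙ (tabulate h) g x)
                            (trans (VecP.lookup∘tabulate h (lookup g x)) (trans (hg≗id x) (sym (VecP.lookup-allFin x)))))

  open FiniteGroup (VecP.≡-dec _≟ᶠ_) ⊙-isMonoid automorphisms Unique-separatingHoms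
                   allFin∈automorphisms ⊙-closed ⊙-inverse
    using (product; p∤order)

  lookup-power : ∀ g k x → lookup (product (replicate k g)) x ≡ fold x (lookup g) k
  lookup-power g zero    x = VecP.lookup-allFin x
  lookup-power g (suc k) x = trans (lookup-⊙ g (product (replicate k g)) x) (cong (lookup g) (lookup-power g k x))

  iter≡fold : ∀ {A : Set} k (f : A → A) x → iter {σ} {r} k f x ≡ fold x f k
  iter≡fold zero    f x = refl
  iter≡fold (suc k) f x = cong f (iter≡fold k f x)

  rigid⇒p∤|Aut| : ∀ {p} → Prime p → PRigid p G → ¬ p ∣ hom≢ G G (distinctPairs n)
  rigid⇒p∤|Aut| {p} p-prime rigid = p∤order p-prime no-element-of-order-p
    where
    no-element-of-order-p : ∀ {g} → g ∈ automorphisms → product (replicate p g) ≡ Vec.allFin n → g ≡ Vec.allFin n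
    no-element-of-order-p {g} g∈ gᵖ≡1 with VecP.≡-dec _≟ᶠ_ g (Vec.allFin n)
    ... | yes g≡1 = g≡1
    ... | no  g≢1 = contradiction order-p (rigid (lookup g))
      where
      period-p : ∀ v → fold v (lookup g) p ≡ v
      period-p v = trans (sym (lookup-power g p v)) (trans (cong (λ h → lookup h v) gᵖ≡1) (VecP.lookup-allFin v))
      g-iso : IsIso G G (lookup g)
      g-iso = let g-hom , g-inj = ∈-automorphisms⁻ g∈ in injective-homs⇒IsIso g-hom g-inj g-hom g-inj
      order-p : AutOfOrder p G (lookup g)
      order-p = g-iso , (λ v → trans (iter≡fold p (lookup g) v) (period-p v)) , λ k 0<k k<p gᵏ≗id →
        g≢1 (lookup-ext λ v → trans (prime-period⇒fixed (lookup g) p-prime 0<k k<p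
                                                        (trans (sym (iter≡fold k (lookup g) v)) (gᵏ≗id v)) (period-p v))
                                    (sym (VecP.lookup-allFin v)))

module _ {σ : Sig} {r : ℕ} {p : ℕ} (p-prime : Prime p) where

  injective-hom : ∀ {K L : Str σ r} → PRigid p K →
    hom≢ K L (distinctPairs (size K)) ≡ hom≢ K K (distinctPairs (size K)) [mod p ] →
    ∃ λ f → IsHom K L f × Injective _≡_ _≡_ f
  injective-hom {K} {L} rigid congruent with separatingHoms K L (distinctPairs (size K)) in eq
  -- without injective homomorphisms the congruence reads p ∣ |Aut K|
  ... | []    = contradiction congruent (rigid⇒p∤|Aut| K p-prime rigid)
  ... | v ∷ _ = let v-hom , v-sep = ∈-separatingHoms⁻ (subst (v ∈_) (sym eq) (here refl)) in
                lookup v , v-hom , Separates-distinctPairs⇒injective v-sep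

lemma3p4 : (p : ℕ) → Prime p → (σ : Sig) (r : ℕ) (G H : Str σ r) →
    PRigid p G → PRigid p H →
    (G ≅ H) ⇔ (∀ (K : Str σ r) → hom K G ≡ hom K H [mod p ])
lemma3p4 p p-prime σ r G H G-rigid H-rigid = mk⇔ isomorphic⇒congruent congruent⇒isomorphic
  where
  isomorphic⇒congruent : G ≅ H → ∀ K → hom K G ≡ hom K H [mod p ]
  isomorphic⇒congruent G≅H K = subst (hom K G ≡_[mod p ]) (≅⇒hom≡ G≅H K) (mod-refl (hom K G))

  congruent⇒isomorphic : (∀ K → hom K G ≡ hom K H [mod p ]) → G ≅ H
  congruent⇒isomorphic hom≡ =
    let f , f-hom , f-inj = injective-hom p-prime G-rigid
                              (mod-sym (hom≢ G G Dᴳ) (hom≢ G H Dᴳ) (hom≢-congruent hom≡ G Dᴳ))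
        g , g-hom , g-inj = injective-hom p-prime H-rigid (hom≢-congruent hom≡ H (distinctPairs (size H)))
    in f , injective-homs⇒IsIso f-hom f-inj g-hom g-inj
    where
    Dᴳ : Pairs G
    Dᴳ = distinctPairs (size G)
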